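{- Let $\alpha>0$ be an ordinal and let $(A_\eta)_{\eta<\alpha}$ be an increasing sequence of open subsets of $\mathbb{N}^\mathbb{N}$. If $S=D_\alpha((A_\eta)_{\eta<\alpha})$, then $S$ is guessable with $<\alpha+1$ mind changes.
   Context: $\mathbb{N}^\mathbb{N}$ has the Baire space topology (basic open sets: all extensions of a fixed finite sequence). $\mathbb{N}^{<\mathbb{N}}$ is the set of finite sequences; $f\upharpoonright n$ is the length-$n$ initial segment of $f$; $\chi_S$ is the characteristic function of $S$. $G:\mathbb{N}^{<\mathbb{N}}\to\{0,1\}$ is an $S$-guesser if $\lim_nG(f\upharpoonright n)=\chi_S(f)$ for all $f$. For an ordinal $\gamma$, $S$ is guessable with $<\gamma$ mind changes if there are an $S$-guesser $G$ and $H:\mathbb{N}^{<\mathbb{N}}\to\gamma$ such that for all $f,n$: $H(f\upharpoonright(n+1))\le H(f\upharpoonright n)$, and if $G(f\upharpoonright(n+1))\ne G(f\upharpoonright n)$ then $H(f\upharpoonright(n+1))<H(f\upharpoonright n)$. The parity of an ordinal $\eta=\lambda+n$ ($\lambda$ zero or limit, $n\in\mathbb{N}$) is $n\bmod2$. For $\theta\ge1$ and increasing $(A_\eta)_{\eta<\theta}$, $x\in D_\theta((A_\eta)_{\eta<\theta})$ iff $x\in\bigcup_{\eta<\theta}A_\eta$ and the least $\eta$ with $x\in A_\eta$ has parity opposite to that of $\theta$. -}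

module Defs where

open import Level using (0ℓ)
open import Data.Nat using (ℕ; zero; suc; _≤_)
open import Data.Bool using (Bool; true; false; not)
open import Data.List using (List; []; _++_; [_])
open import Data.Product using (Σ; ∃; _×_; _,_)
open import Data.Sum using (_⊎_; inj₁; inj₂)
open import Data.Unit using (⊤; tt)
open import Data.Empty using (⊥)
open import Relation.Nullary using (¬_)
open import Relation.Binary.PropositionalEquality using (_≡_; _≢_)
open import Relation.Binary using (Rel)
open import Induction.WellFounded using (WellFounded)

-- Law of excluded middle (the paper works classically).
LEM : Set₁
LEM = (P : Set) → P ⊎ ¬ P

Baire : Set
Baire = ℕ → ℕ

FinSeq : Set
FinSeq = List ℕ

_↾_ : Baire → ℕ → FinSeq
f ↾ zero  = []
f ↾ suc n = (f ↾ n) ++ [ f n ]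

IsOpen : (Baire → Set) → Set
IsOpen A = ∀ f → A f → ∃ λ n → ∀ g → g ↾ n ≡ f ↾ n → A g

-- An ordinal, represented (up to isomorphism) by a well-ordered set:
-- a strict, linear, well-founded order.
record Ordinal : Set₁ where
  field
    Carrier : Set
    _<_     : Rel Carrier 0ℓ
    irrefl  : ∀ a → ¬ (a < a)
    trans   : ∀ {a b c} → a < b → b < c → a < c
    linear  : ∀ a b → ¬ (a < b) → ¬ (b < a) → a ≡ b
    wf      : WellFounded _<_

open Ordinal public

-- The ordinal α+1 = α ∪ {α}: carrier α ⊎ ⊤, with inj₂ tt playing the role of α.
Succ : Ordinal → Set
Succ α = Carrier α ⊎ ⊤

data _<⁺_ {α : Ordinal} : Succ α → Succ α → Set where
  old : ∀ {a b} → _<_ α a b → inj₁ a <⁺ inj₁ b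
  top : ∀ {a} → inj₁ a <⁺ inj₂ tt

IsPred : {X : Set} → Rel X 0ℓ → X → X → Set
IsPred _<_ ξ η = ξ < η × (∀ ζ → ζ < η → ¬ (ξ < ζ))

-- Parity of an ordinal η = λ + n (λ zero or limit): n mod 2, with true = odd.
data Parity {X : Set} (_<_ : Rel X 0ℓ) : X → Bool → Set where
  limitOrZero : ∀ {η} → ¬ (∃ λ ξ → IsPred _<_ ξ η) → Parity _<_ η false
  successor   : ∀ {ξ η b} → IsPred _<_ ξ η → Parity _<_ ξ b → Parity _<_ η (not b)

ParityOrd : Ordinal → Bool → Set
ParityOrd α b = Parity (_<⁺_ {α}) (inj₂ tt) b

Increasing : (α : Ordinal) → (Carrier α → Baire → Set) → Set
Increasing α A = ∀ η ζ → _<_ α η ζ → ∀ f → A η f → A ζ f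

D : (α : Ordinal) → (Carrier α → Baire → Set) → Baire → Set
D α A x = Σ (Carrier α) λ η → A η x × (∀ ζ → _<_ α ζ η → ¬ A ζ x)
            × Σ Bool λ b → Parity (_<_ α) η b × ParityOrd α (not b)

IsGuesser : (Baire → Set) → (FinSeq → Bool) → Set
IsGuesser S G = ∀ f → ∃ λ N → ∀ n → N ≤ n → (G (f ↾ n) ≡ true → S f) × (S f → G (f ↾ n) ≡ true)

GuessableWith : (Baire → Set) → (Γ : Set) → Rel Γ 0ℓ → Set
GuessableWith S Γ _<_ =
  Σ (FinSeq → Bool) λ G → Σ (FinSeq → Γ) λ H →
    IsGuesser S G ×
    (∀ f n → (H (f ↾ suc n) < H (f ↾ n) ⊎ H (f ↾ suc n) ≡ H (f ↾ n))
           × (G (f ↾ suc n) ≢ G (f ↾ n) → H (f ↾ suc n) < H (f ↾ n)))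

-- Let rank s be the least η such that the whole cone of extensions of s lies in A_η
-- (α if there is none), and let the guess be "the parity of rank s is opposite to
-- that of α". Cones shrink along f, so rank (f ↾ n) is non-increasing, and the guess
-- can only change when the rank drops. If η₀ is least with f ∈ A_η₀, openness puts
-- a whole cone around f inside A_η₀, while any A_η containing a cone around f
-- contains f, so η₀ ≤ η; hence the rank stabilises at η₀ and the guess converges to
-- χ_{D_α}(f). If f lies in no A_η, the rank is constantly α and the guess is false.
module Submission where

open import Defs
open import Data.Nat using (zero; suc; _+_; _≤_; _≤′_; ≤′-refl; ≤′-step)
open import Data.Nat.Properties using (+-comm; ≤⇒≤′; n≤1+n)
open import Data.Bool using (Bool; true; not)
open import Data.List using (length; _++_; [_])
open import Data.List.Properties using (length-++; ∷ʳ-injectiveˡ)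
open import Data.Product using (Σ; ∃; ∃₂; _×_; _,_; proj₁; proj₂)
open import Data.Sum using (_⊎_; inj₁; inj₂)
open import Data.Unit using (tt)
open import Data.Empty using (⊥; ⊥-elim)
open import Function using (_∘_)
open import Function.Bundles using (_⇔_; mk⇔; Equivalence)
open import Function.Construct.Composition using (_⇔-∘_)
open import Relation.Nullary using (¬_; Dec; does)
open import Relation.Nullary.Decidable using (fromSum)
open import Relation.Binary.PropositionalEquality
  using (_≡_; _≢_; refl; sym; cong; subst; module ≡-Reasoning)
open import Induction.WellFounded using (Acc; acc)

length-↾ : ∀ f n → length (f ↾ n) ≡ n
length-↾ f zero    = refl
length-↾ f (suc n) = begin
  length ((f ↾ n) ++ [ f n ]) ≡⟨ length-++ (f ↾ n) ⟩
  length (f ↾ n) + 1          ≡⟨ +-comm (length (f ↾ n)) 1 ⟩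
  suc (length (f ↾ n))        ≡⟨ cong suc (length-↾ f n) ⟩
  suc n                       ∎
  where open ≡-Reasoning

↾-agree-≤ : ∀ {g f : Baire} {N n} → N ≤ n → g ↾ n ≡ f ↾ n → g ↾ N ≡ f ↾ N
↾-agree-≤ {g} {f} = agree ∘ ≤⇒≤′
  where
  agree : ∀ {N n} → N ≤′ n → g ↾ n ≡ f ↾ n → g ↾ N ≡ f ↾ N
  agree ≤′-refl         eq = eq
  agree (≤′-step {n} p) eq = agree p (∷ʳ-injectiveˡ (g ↾ n) (f ↾ n) eq)

module _ (α : Ordinal) where

  IsLeast : (Carrier α → Set) → Carrier α → Set
  IsLeast R η = R η × (∀ ζ → _<_ α ζ η → ¬ R ζ)

  IsLeast-unique : ∀ {R a b} → IsLeast R a → IsLeast R b → a ≡ b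
  IsLeast-unique (Ra , a-min) (Rb , b-min) =
    linear α _ _ (λ a<b → b-min _ a<b Ra) (λ b<a → a-min _ b<a Rb)

  IsLeast-restrict : ∀ {R R′ a} → (∀ η → R η → R′ η) → IsLeast R′ a → R a → IsLeast R a
  IsLeast-restrict R⊆R′ (_ , a-min) Ra = Ra , λ ζ ζ<a Rζ → a-min ζ ζ<a (R⊆R′ ζ Rζ)

module Classical (lem : LEM) where

  decide : (P : Set) → Dec P
  decide P = fromSum (lem P)

  does-decide : ∀ P → does (decide P) ≡ true ⇔ P
  does-decide P with lem P
  ... | inj₁ holds = mk⇔ (λ _ → holds) (λ _ → refl)
  ... | inj₂ fails = mk⇔ (λ ()) (⊥-elim ∘ fails)

  least : (α : Ordinal) {R : Carrier α → Set} → ∀ η → R η → ∃ (IsLeast α R)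
  least α {R} η = below η (wf α η)
    where
    below : ∀ η → Acc (_<_ α) η → R η → ∃ (IsLeast α R)
    below η (acc smaller) Rη with lem (∃ λ ζ → _<_ α ζ η × R ζ)
    ... | inj₁ (ζ , ζ<η , Rζ) = below ζ (smaller ζ<η) Rζ
    ... | inj₂ none           = η , Rη , λ ζ ζ<η Rζ → none (ζ , ζ<η , Rζ)

  IsLeast-antitone : (α : Ordinal) {R R′ : Carrier α → Set} {a b : Carrier α} →
                     (∀ η → R η → R′ η) → IsLeast α R a → IsLeast α R′ b →
                     _<_ α b a ⊎ b ≡ a
  IsLeast-antitone α R⊆R′ (Ra , _) (_ , b-min) with lem (_<_ α _ _)
  ... | inj₁ b<a = inj₁ b<a
  ... | inj₂ b≮a = inj₂ (linear α _ _ b≮a (λ a<b → b-min _ a<b (R⊆R′ _ Ra)))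

module MindChangeRank (lem : LEM) (α : Ordinal) (A : Carrier α → Baire → Set) where
  open Classical lem

  _≺_ : Succ α → Succ α → Set
  _≺_ = _<⁺_ {α}

  Covers : FinSeq → Carrier α → Set
  Covers s η = ∀ g → g ↾ length s ≡ s → A η g

  cone⇒Covers : ∀ f n {η} → (∀ g → g ↾ n ≡ f ↾ n → A η g) → Covers (f ↾ n) η
  cone⇒Covers f n inA g = inA g ∘ subst (λ m → g ↾ m ≡ f ↾ n) (length-↾ f n)

  Covers⇒cone : ∀ f n {η} → Covers (f ↾ n) η → ∀ g → g ↾ n ≡ f ↾ n → A η g
  Covers⇒cone f n covers g = covers g ∘ subst (λ m → g ↾ m ≡ f ↾ n) (sym (length-↾ f n))

  Covers-self : ∀ f n η → Covers (f ↾ n) η → A η f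
  Covers-self f n η covers = Covers⇒cone f n covers f refl

  Covers-extend : ∀ f n η → Covers (f ↾ n) η → Covers (f ↾ suc n) η
  Covers-extend f n η covers =
    cone⇒Covers f (suc n) λ g eq → Covers⇒cone f n covers g (↾-agree-≤ (n≤1+n n) eq)

  data LeastCover (s : FinSeq) : Succ α → Set where
    cover    : ∀ {η} → IsLeast α (Covers s) η → LeastCover s (inj₁ η)
    no-cover : ¬ ∃ (Covers s) → LeastCover s (inj₂ tt)

  leastCover : ∀ s → ∃ (LeastCover s)
  leastCover s with lem (∃ (Covers s))
  ... | inj₂ none         = inj₂ tt , no-cover none
  ... | inj₁ (η , covers) with least α η covers
  ... | η₀ , η₀-least     = inj₁ η₀ , cover η₀-least

  rank : FinSeq → Succ α
  rank s = proj₁ (leastCover s)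

  rank-spec : ∀ s → LeastCover s (rank s)
  rank-spec s = proj₂ (leastCover s)

  LeastCover-antitone : ∀ {s t x y} → (∀ η → Covers s η → Covers t η) →
                        LeastCover s x → LeastCover t y → y ≺ x ⊎ y ≡ x
  LeastCover-antitone s⊆t (cover least-s) (cover least-t)
    with IsLeast-antitone α s⊆t least-s least-t
  ... | inj₁ lt   = inj₁ (old lt)
  ... | inj₂ refl = inj₂ refl
  LeastCover-antitone s⊆t (no-cover _)  (cover _)    = inj₁ top
  LeastCover-antitone s⊆t (no-cover _)  (no-cover _) = inj₂ refl
  LeastCover-antitone s⊆t (cover (covers , _)) (no-cover none) = ⊥-elim (none (_ , s⊆t _ covers))

  LeastCover-inj₁ : ∀ {s x η} → LeastCover s x → IsLeast α (Covers s) η → x ≡ inj₁ η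
  LeastCover-inj₁ (cover least-x)  least-η = cong inj₁ (IsLeast-unique α least-x least-η)
  LeastCover-inj₁ (no-cover none) (covers , _) = ⊥-elim (none (_ , covers))

  LeastCover-inj₂ : ∀ {s x} → LeastCover s x → ¬ ∃ (Covers s) → x ≡ inj₂ tt
  LeastCover-inj₂ (cover (covers , _)) none = ⊥-elim (none (_ , covers))
  LeastCover-inj₂ (no-cover _)         _    = refl

  rank-antitone : ∀ f n → rank (f ↾ suc n) ≺ rank (f ↾ n) ⊎ rank (f ↾ suc n) ≡ rank (f ↾ n)
  rank-antitone f n = LeastCover-antitone (Covers-extend f n) (rank-spec (f ↾ n)) (rank-spec (f ↾ suc n))

  OppositeParity : Carrier α → Set
  OppositeParity η = Σ Bool λ b → Parity (_<_ α) η b × ParityOrd α (not b)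

  Accepts : Succ α → Set
  Accepts (inj₁ η) = OppositeParity η
  Accepts (inj₂ _) = ⊥

  guess : FinSeq → Bool
  guess s = does (decide (Accepts (rank s)))

  rank-drops-on-mind-change : ∀ f n → guess (f ↾ suc n) ≢ guess (f ↾ n) →
                              rank (f ↾ suc n) ≺ rank (f ↾ n)
  rank-drops-on-mind-change f n changed with rank-antitone f n
  ... | inj₁ dropped = dropped
  ... | inj₂ same    = ⊥-elim (changed (cong (does ∘ decide ∘ Accepts) same))

  rank-stabilises : (∀ η → IsOpen (A η)) → ∀ f →
                    ∃₂ λ ρ N → (Accepts ρ ⇔ D α A f) × (∀ n → N ≤ n → rank (f ↾ n) ≡ ρ)
  rank-stabilises open-A f with lem (∃ λ η → A η f)
  ... | inj₂ outside =
    inj₂ tt , 0 , mk⇔ (λ ()) (λ (η , inA , _) → outside (η , inA)) ,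
    λ n _ → LeastCover-inj₂ (rank-spec (f ↾ n)) (λ (η , covers) → outside (η , Covers-self f n η covers))
  ... | inj₁ (η , inA) with least α η inA
  ... | η₀ , least₀@(inA₀ , η₀-min) with open-A η₀ f inA₀
  ... | N , cone⊆A₀ =
    inj₁ η₀ , N , mk⇔ (λ opposite → η₀ , inA₀ , η₀-min , opposite) accepts ,
    λ n N≤n → LeastCover-inj₁ (rank-spec (f ↾ n))
                (IsLeast-restrict α (Covers-self f n) least₀ (covers n N≤n))
    where
    accepts : D α A f → OppositeParity η₀
    accepts (η , inA , η-min , opposite) =
      subst OppositeParity (IsLeast-unique α (inA , η-min) least₀) opposite
    covers : ∀ n → N ≤ n → Covers (f ↾ n) η₀
    covers n N≤n = cone⇒Covers f n λ g eq → cone⊆A₀ g (↾-agree-≤ N≤n eq)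

  guess-converges : (∀ η → IsOpen (A η)) → IsGuesser (D α A) guess
  guess-converges open-A f with rank-stabilises open-A f
  ... | ρ , N , accepts⇔D , stable = N , λ n N≤n →
    let guess⇔D = subst (λ x → Accepts x ⇔ D α A f) (sym (stable n N≤n)) accepts⇔D
                    ⇔-∘ does-decide (Accepts (rank (f ↾ n)))
    in Equivalence.to guess⇔D , Equivalence.from guess⇔D

proposition4p4 : LEM → (α : Ordinal) → Carrier α → (A : Carrier α → Baire → Set)
                 → (∀ η → IsOpen (A η)) → Increasing α A
                 → GuessableWith (D α A) (Succ α) (_<⁺_ {α})
proposition4p4 lem α _ A open-A _ =
  guess , rank , guess-converges open-A , λ f n → rank-antitone f n , rank-drops-on-mind-change f n
  where open MindChangeRank lem α A
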